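{- Let $X$ and $Y$ be join-semilattices and $n,m$ positive integers such that $X$ is $\overline{n}^{\top}$-free and $Y$ is $\overline{m}^{\top}$-free. Then every quasi-product of $X$ and $Y$ is $\overline{(n+m-1)}^{\top}$-free.
   Context: For $k\in\omega$, $\overline{k}^{\top}$ is the join-semilattice on $\{0,\dots,k-1\}\sqcup\{\mathbf 1\}$ with $x\vee y=\mathbf 1$ for all distinct $x,y$; a join-semilattice is $\overline{k}^{\top}$-free if it has no join-subsemilattice isomorphic to $\overline{k}^{\top}$. A quasi-product of join-semilattices $X$ and $Y$ is a join-semilattice structure on the set $X\times Y$ such that (q1) for every $x\in X$ the map $y\mapsto(x,y)$ is an order-embedding of $Y$ into $X\times Y$, and (q2) the projection $\pi_X:X\times Y\to X$ is a join-homomorphism. -}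

module Defs where

open import Level using (Level; _⊔_) renaming (suc to lsuc)
open import Data.Nat using (ℕ)
open import Data.Fin using (Fin; _≟_)
open import Data.Maybe using (Maybe; just; nothing)
open import Data.Product using (_×_; _,_; proj₁)
open import Data.Product.Relation.Binary.Pointwise.NonDependent using (Pointwise)
open import Relation.Nullary using (¬_; yes; no)
open import Relation.Binary.PropositionalEquality using (_≡_)
open import Relation.Binary.Lattice using (JoinSemilattice; IsJoinSemilattice)
open import Relation.Binary.Core using (Rel)
open import Algebra.Core using (Op₂)

-- The join-semilattice  k̄⊤ : carrier  Maybe (Fin k), where  just i  is the
-- atom i and  nothing  is the top element 1;  x ∨ y = 1  for distinct x, y.
kTop-join : (k : ℕ) → Op₂ (Maybe (Fin k))
kTop-join k nothing  _        = nothing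
kTop-join k (just i) nothing  = nothing
kTop-join k (just i) (just j) with i ≟ j
... | yes _ = just i
... | no  _ = nothing

-- L contains a join-subsemilattice isomorphic to k̄⊤:
-- an injective join-homomorphism  k̄⊤ → L  (its image is such a subsemilattice,
-- and conversely any such subsemilattice yields such a map).
record Contains-kTop {c ℓ₁ ℓ₂ : Level} (L : JoinSemilattice c ℓ₁ ℓ₂) (k : ℕ)
       : Set (c ⊔ ℓ₁) where
  open JoinSemilattice L
  field
    emb       : Maybe (Fin k) → Carrier
    injective : ∀ a b → emb a ≈ emb b → a ≡ b
    join-hom  : ∀ a b → emb (kTop-join k a b) ≈ (emb a ∨ emb b)

kTop-free : {c ℓ₁ ℓ₂ : Level} → JoinSemilattice c ℓ₁ ℓ₂ → ℕ → Set (c ⊔ ℓ₁)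
kTop-free L k = ¬ Contains-kTop L k

record QuasiProduct {c₁ ℓ₁ ℓ₁' c₂ ℓ₂ ℓ₂' : Level}
       (X : JoinSemilattice c₁ ℓ₁ ℓ₁') (Y : JoinSemilattice c₂ ℓ₂ ℓ₂') (ℓ : Level)
       : Set (c₁ ⊔ ℓ₁ ⊔ ℓ₁' ⊔ c₂ ⊔ ℓ₂ ⊔ ℓ₂' ⊔ lsuc ℓ) where
  private
    module X = JoinSemilattice X
    module Y = JoinSemilattice Y
  field
    _≤_ : Rel (X.Carrier × Y.Carrier) ℓ
    _∨_ : Op₂ (X.Carrier × Y.Carrier)
    isJoinSemilattice : IsJoinSemilattice (Pointwise X._≈_ Y._≈_) _≤_ _∨_
    q1-mono    : ∀ x y y' → y Y.≤ y' → (x , y) ≤ (x , y')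
    q1-reflect : ∀ x y y' → (x , y) ≤ (x , y') → y Y.≤ y'
    q2 : ∀ p q → proj₁ (p ∨ q) X.≈ (proj₁ p X.∨ proj₁ q)

  joinSemilattice : JoinSemilattice (c₁ ⊔ c₂) (ℓ₁ ⊔ ℓ₂) ℓ
  joinSemilattice = record { isJoinSemilattice = isJoinSemilattice }

{-# OPTIONS --safe #-}
module Submission where

open import Defs
open import Level using (Level)
open import Data.Nat using (ℕ; _+_; _∸_; _≤_)
open import Relation.Binary.Lattice using (JoinSemilattice)

open import Data.Nat using (zero; suc; s≤s)
open import Data.Nat.Properties using (+-suc; m+n≤o⇒n≤o; m≤n+m∸n)
open import Data.Fin using (Fin; _≟_) renaming (zero to fzero; suc to fsuc)
open import Data.Fin.Properties using (suc-injective; ∀-cons)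
open import Data.Maybe using (Maybe; just; nothing)
open import Data.Product using (_,_; proj₁; proj₂)
import Data.Sum as Sum
open import Data.Sum using (_⊎_; inj₁; inj₂)
open import Data.Vec.Functional using (_∷_)
open import Effect.Monad using (RawMonad)
open import Function using (_∘_)
open import Function.Definitions using (Injective)
open import Relation.Nullary using (¬_; yes; no; contradiction; ¬¬-excluded-middle)
open import Relation.Nullary.Negation using (¬¬-Monad)
open import Relation.Unary using (Pred; ∁; Decidable)
open import Relation.Binary.PropositionalEquality using (_≡_; _≢_; refl; cong; subst)
import Relation.Binary.Lattice.Properties.JoinSemilattice as JoinSemilatticeProperties

-- Let a k̄⊤ with k = n + m − 1 sit in a quasi-product, with top (x , y). By (q2) the first
-- projection preserves joins, so the atoms whose first coordinate differs from x project to
-- a copy of r̄⊤ in X with top x, r being their number. The remaining atoms lie in the fibre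
-- {x} × Y, which (q1) embeds as an order, so their second coordinates form a copy in Y with
-- top y. By pigeonhole, the first group has at least n atoms or the second at least m.
-- Equality in X need not be decidable, so the split is made under a double negation, which
-- is harmless because the goal is ⊥.

kTop-join-≢ : ∀ k {i j : Fin k} → i ≢ j → kTop-join k (just i) (just j) ≡ nothing
kTop-join-≢ k {i} {j} i≢j with i ≟ j
... | yes i≡j = contradiction i≡j i≢j
... | no  _   = refl

module _ {c ℓ₁ ℓ₂ : Level} (L : JoinSemilattice c ℓ₁ ℓ₂) where
  open JoinSemilattice L renaming (_≤_ to _⊑_; refl to ⊑-refl)
  open JoinSemilatticeProperties L using (∨-idempotent; ∨-cong)

  -- Atom injectivity is not a hypothesis: equal atoms would join to themselves, not to the top.
  contains-kTop : ∀ {r} (top : Carrier) (atom : Fin r → Carrier) →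
    (∀ i → atom i ⊑ top) → (∀ i → ¬ atom i ≈ top) →
    (∀ {i j} → i ≢ j → atom i ∨ atom j ≈ top) → Contains-kTop L r
  contains-kTop {r} top atom atom≤top atom≉top atom∨atom≈top = record
    { emb = emb ; injective = injective ; join-hom = join-hom }
    where
    emb : Maybe (Fin r) → Carrier
    emb nothing  = top
    emb (just i) = atom i

    emb≤top : ∀ a → emb a ⊑ top
    emb≤top nothing  = ⊑-refl
    emb≤top (just i) = atom≤top i

    injective : ∀ a b → emb a ≈ emb b → a ≡ b
    injective nothing  nothing  _  = refl
    injective nothing  (just j) eq = contradiction (Eq.sym eq) (atom≉top j)
    injective (just i) nothing  eq = contradiction eq (atom≉top i)
    injective (just i) (just j) eq with i ≟ j
    ... | yes i≡j = cong just i≡j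
    ... | no  i≢j = contradiction atomᵢ≈top (atom≉top i)
      where
      atomᵢ≈top : atom i ≈ top
      atomᵢ≈top = Eq.trans (Eq.sym (∨-idempotent (atom i)))
                    (Eq.trans (∨-cong Eq.refl eq) (atom∨atom≈top i≢j))

    join-hom : ∀ a b → emb (kTop-join r a b) ≈ emb a ∨ emb b
    join-hom nothing  b        = antisym (x≤x∨y top (emb b)) (∨-least ⊑-refl (emb≤top b))
    join-hom (just i) nothing  = antisym (y≤x∨y (atom i) top) (∨-least (atom≤top i) ⊑-refl)
    join-hom (just i) (just j) with i ≟ j
    ... | yes refl = Eq.sym (∨-idempotent (atom i))
    ... | no  i≢j  = Eq.sym (atom∨atom≈top i≢j)

module Contains-kTop-Properties {c ℓ₁ ℓ₂ : Level} {L : JoinSemilattice c ℓ₁ ℓ₂} {k : ℕ}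
                                (C : Contains-kTop L k) where
  open JoinSemilattice L renaming (_≤_ to _⊑_)
  open Contains-kTop C

  top : Carrier
  top = emb nothing

  atom : Fin k → Carrier
  atom i = emb (just i)

  atom≤top : ∀ i → atom i ⊑ top
  atom≤top i = ≤-respʳ-≈ (Eq.sym (join-hom (just i) nothing)) (x≤x∨y (atom i) top)

  atom≉top : ∀ i → ¬ atom i ≈ top
  atom≉top i eq with injective (just i) nothing eq
  ... | ()

  atom∨atom≈top : ∀ {i j} → i ≢ j → atom i ∨ atom j ≈ top
  atom∨atom≈top {i} {j} i≢j =
    Eq.sym (subst (λ a → emb a ≈ atom i ∨ atom j) (kTop-join-≢ k i≢j) (join-hom (just i) (just j)))

record Selection {p : Level} {n : ℕ} (P : Pred (Fin n) p) (r : ℕ) : Set p where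
  field
    index           : Fin r → Fin n
    index-injective : Injective _≡_ _≡_ index
    index-∈         : ∀ i → P (index i)

selection-zero : ∀ {p n} {P : Pred (Fin n) p} → Selection P 0
selection-zero = record { index = λ () ; index-injective = λ {} ; index-∈ = λ () }

module _ {p : Level} {n : ℕ} {P : Pred (Fin (suc n)) p} where
  open Selection

  selection-suc : ∀ {r} → Selection (P ∘ fsuc) r → Selection P r
  selection-suc s = record
    { index           = fsuc ∘ index s
    ; index-injective = index-injective s ∘ suc-injective
    ; index-∈         = index-∈ s
    }

  selection-cons : ∀ {r} → P fzero → Selection (P ∘ fsuc) r → Selection P (suc r)
  selection-cons {r} p₀ s = record
    { index           = fzero ∷ fsuc ∘ index s
    ; index-injective = injective
    ; index-∈         = ∀-cons p₀ (index-∈ s)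
    }
    where
    injective : Injective _≡_ _≡_ (fzero ∷ fsuc ∘ index s)
    injective {fzero}  {fzero}  _  = refl
    injective {fsuc i} {fsuc j} eq = cong fsuc (index-injective s (suc-injective eq))

pigeonhole : ∀ {p k} {P : Pred (Fin k) p} → Decidable P →
             ∀ n m → n + m ≤ suc k → Selection (∁ P) n ⊎ Selection P m
pigeonhole P? zero    m    _ = inj₁ selection-zero
pigeonhole P? (suc n) zero _ = inj₂ selection-zero
pigeonhole {k = zero} P? (suc n) (suc m) (s≤s n+1+m≤0) with m+n≤o⇒n≤o n n+1+m≤0
... | ()
pigeonhole {k = suc k} P? (suc n) (suc m) (s≤s n+1+m≤1+k) with P? fzero
... | yes p₀ = Sum.map selection-suc (selection-cons p₀)
                 (pigeonhole (P? ∘ fsuc) (suc n) m (subst (_≤ suc k) (+-suc n m) n+1+m≤1+k))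
... | no ¬p₀ = Sum.map (selection-cons ¬p₀) selection-suc
                 (pigeonhole (P? ∘ fsuc) n (suc m) n+1+m≤1+k)

¬¬-decidable : ∀ {p k} (P : Pred (Fin k) p) → ¬ ¬ Decidable P
¬¬-decidable {k = zero}  P ¬P? = ¬P? (λ ())
¬¬-decidable {k = suc k} P = do
  P₀? ← ¬¬-excluded-middle
  P₊? ← ¬¬-decidable (P ∘ fsuc)
  pure (∀-cons P₀? P₊?)
  where open RawMonad ¬¬-Monad

module QuasiProductProperties {c₁ ℓ₁ ℓ₁' c₂ ℓ₂ ℓ₂' ℓ : Level}
  {X : JoinSemilattice c₁ ℓ₁ ℓ₁'} {Y : JoinSemilattice c₂ ℓ₂ ℓ₂'} (Q : QuasiProduct X Y ℓ) where
  private
    module X = JoinSemilattice X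
    module Y = JoinSemilattice Y
    module Q = JoinSemilattice (QuasiProduct.joinSemilattice Q)
  open QuasiProduct Q using (q1-mono; q1-reflect; q2)
  open JoinSemilatticeProperties (QuasiProduct.joinSemilattice Q) using (x≤y⇒x∨y≈y)

  proj₁-mono : ∀ {p q} → p Q.≤ q → proj₁ p X.≤ proj₁ q
  proj₁-mono {p} {q} p≤q =
    X.≤-respʳ-≈ (X.Eq.trans (X.Eq.sym (q2 p q)) (proj₁ (x≤y⇒x∨y≈y p≤q))) (X.x≤x∨y _ _)

  module Atoms {k : ℕ} (C : Contains-kTop (QuasiProduct.joinSemilattice Q) k) where
    open Contains-kTop-Properties C

    OnTopFibre : Pred (Fin k) ℓ₁
    OnTopFibre i = proj₁ (atom i) X.≈ proj₁ top

    off-top-fibre⇒contains-kTop : ∀ {r} → Selection (∁ OnTopFibre) r → Contains-kTop X r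
    off-top-fibre⇒contains-kTop s = contains-kTop X (proj₁ top) (proj₁ ∘ atom ∘ index)
      (λ i → proj₁-mono (atom≤top (index i)))
      index-∈
      (λ i≢j → X.Eq.trans (X.Eq.sym (q2 _ _)) (proj₁ (atom∨atom≈top (i≢j ∘ index-injective))))
      where open Selection s

    in-top-fibre⇒contains-kTop : ∀ {r} → Selection OnTopFibre r → Contains-kTop Y r
    in-top-fibre⇒contains-kTop {r} s = contains-kTop Y (proj₂ top) y y≤top
      (λ i yᵢ≈top → atom≉top (index i) (index-∈ i , yᵢ≈top))
      (λ {i} {j} i≢j → Y.antisym (Y.∨-least (y≤top i) (y≤top j))
                         (q1-reflect xₜ _ _ (top≤fibre i≢j)))
      where
      open Selection s

      xₜ : X.Carrier
      xₜ = proj₁ top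

      y : Fin r → Y.Carrier
      y = proj₂ ∘ atom ∘ index

      atom≈fibre : ∀ i → atom (index i) Q.≈ (xₜ , y i)
      atom≈fibre i = index-∈ i , Y.Eq.refl

      atom≤fibre : ∀ i {b} → y i Y.≤ b → atom (index i) Q.≤ (xₜ , b)
      atom≤fibre i yᵢ≤b = Q.≤-respˡ-≈ (Q.Eq.sym (atom≈fibre i)) (q1-mono xₜ _ _ yᵢ≤b)

      y≤top : ∀ i → y i Y.≤ proj₂ top
      y≤top i = q1-reflect xₜ _ _ (Q.≤-respˡ-≈ (atom≈fibre i) (atom≤top (index i)))

      top≤fibre : ∀ {i j} → i ≢ j → top Q.≤ (xₜ , y i Y.∨ y j)
      top≤fibre {i} {j} i≢j = Q.≤-respˡ-≈ (atom∨atom≈top (i≢j ∘ index-injective))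
        (Q.∨-least (atom≤fibre i (Y.x≤x∨y _ _)) (atom≤fibre j (Y.y≤x∨y _ _)))

-- The positivity hypotheses are unused: n + m ≤ 1 + (n + m ∸ 1) holds for all n, m.
proposition3p8 : {c₁ ℓ₁ ℓ₁' c₂ ℓ₂ ℓ₂' ℓ : Level}
    (X : JoinSemilattice c₁ ℓ₁ ℓ₁') (Y : JoinSemilattice c₂ ℓ₂ ℓ₂') (n m : ℕ) →
    1 ≤ n → 1 ≤ m → kTop-free X n → kTop-free Y m →
    (Q : QuasiProduct X Y ℓ) → kTop-free (QuasiProduct.joinSemilattice Q) (n + m ∸ 1)
proposition3p8 X Y n m _ _ X-free Y-free Q C =
  ¬¬-decidable OnTopFibre λ onTopFibre? →
    Sum.[ X-free ∘ off-top-fibre⇒contains-kTop , Y-free ∘ in-top-fibre⇒contains-kTop ]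
      (pigeonhole onTopFibre? n m (m≤n+m∸n (n + m) 1))
  where open QuasiProductProperties.Atoms Q C
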